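{- Let $G$ be a connected graph without isolated vertices, let $\mathcal{R}$ be a subset of its vertex set, let $MMPD$ be a maximum matched-paired-dominating set of $G$ w.r.t. $\mathcal{R}$, and let $\upsilon\in\mathcal{R}-V(MMPD)$. Then: (1) if $\{v_f,\tilde v_f\}$ is a free-paired-edge in $MMPD$, then $\upsilon$ is adjacent to neither $v_f$ nor $\tilde v_f$; (2) $N_G(\upsilon)\subseteq V(MMPD)$; (3) if $\{v_x,\tilde v_x\}$ is a semi-paired-edge or a full-paired-edge in $MMPD$ and $\upsilon$ is adjacent to $v_x$, then $N_G(\tilde v_x)-\{\upsilon\}\subseteq V(MMPD)$; (4) if $\{v_f,v_r\}$ is a semi-paired-edge in $MMPD$ with restricted vertex $v_r\in\mathcal{R}$, then $\upsilon$ is not adjacent to $v_r$.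
   Context: All graphs are finite, simple and undirected; $N_G(v)$ is the open neighborhood of $v$. For a graph $G=(V,E)$ without isolated vertices and $\mathcal{R}\subseteq V$ (vertices of $\mathcal{R}$ are called restricted, others free): a set $S\subseteq V$ is a paired-dominating set if every vertex of $V-S$ has a neighbor in $S$ and $G[S]$ has a perfect matching. A set $MPD\subseteq E$ is a matched-paired-dominating set if it is a perfect matching of $G[S]$ for some paired-dominating set $S$; $V(MPD)$ is the set of vertices incident to edges of $MPD$. The matched number of $MPD$ is $|V(MPD)\cap\mathcal{R}|$, and a maximum matched-paired-dominating set w.r.t. $\mathcal{R}$ is one whose matched number is the largest possible. An edge of $MPD$ is a full-paired-edge if both endpoints are in $\mathcal{R}$, a semi-paired-edge if exactly one endpoint is in $\mathcal{R}$, and a free-paired-edge if no endpoint is in $\mathcal{R}$. -}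

module Defs where

open import Data.Nat using (ℕ; _≤_)
open import Data.Bool using (Bool; true; false; T)
open import Data.Fin using (Fin)
open import Data.Fin.Subset using (Subset; _∈_; _∉_; _∩_; ∣_∣)
open import Data.Vec using (tabulate)
open import Data.Product using (Σ; ∃; ∃-syntax; _×_; _,_)
open import Relation.Binary.PropositionalEquality using (_≡_)
open import Relation.Nullary using (¬_)
open import Relation.Nullary.Decidable using (⌊_⌋)
open import Data.Fin.Properties using (any?)
open import Data.Bool.Properties using (T?)

record Graph (n : ℕ) : Set where
  field
    adj     : Fin n → Fin n → Bool
    adj-sym : ∀ u v → adj u v ≡ adj v u
    irrefl  : ∀ v → adj v v ≡ false

module _ {n : ℕ} (G : Graph n) where
  open Graph G

  Adj : Fin n → Fin n → Set
  Adj u v = T (adj u v)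

  data Walk : Fin n → Fin n → Set where
    here : ∀ {u} → Walk u u
    step : ∀ {u w v} → Adj u w → Walk w v → Walk u v

  Connected : Set
  Connected = ∀ u v → Walk u v

  NoIsolated : Set
  NoIsolated = ∀ v → ∃[ u ] Adj v u

  -- A set of edges, given as a symmetric Bool relation: M u v = true iff {u,v} ∈ MPD.
  EdgeSet : Set
  EdgeSet = Fin n → Fin n → Bool

  InE : EdgeSet → Fin n → Fin n → Set
  InE M u v = T (M u v)

  VM : EdgeSet → Subset n
  VM M = tabulate (λ v → ⌊ any? (λ u → T? (M v u)) ⌋)

  IsMatching : EdgeSet → Set
  IsMatching M = (∀ u v → M u v ≡ M v u)
               × (∀ u v → InE M u v → Adj u v)
               × (∀ u v w → InE M u v → InE M u w → v ≡ w)

  -- S = V(M) is dominating. (M is then, by construction, a perfect matching of G[V(M)].)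
  Dominating : Subset n → Set
  Dominating S = ∀ v → v ∉ S → ∃[ u ] (u ∈ S × Adj v u)

  IsMPD : EdgeSet → Set
  IsMPD M = IsMatching M × Dominating (VM M)

  matchedNumber : Subset n → EdgeSet → ℕ
  matchedNumber R M = ∣ VM M ∩ R ∣

  IsMaxMPD : Subset n → EdgeSet → Set
  IsMaxMPD R M = IsMPD M × (∀ M′ → IsMPD M′ → matchedNumber R M′ ≤ matchedNumber R M)

-- Each claim is proved by contradiction: from a violation we build a matched-paired-dominating
-- set that still covers every restricted vertex of V(M) and in addition covers υ.
-- (2) If υ had an unmatched neighbour w, add the edge υw.
-- (3) If υ ~ x for an edge xy of M and y had an unmatched neighbour w ≠ υ, replace xy by xυ and yw.
-- (1), (4) If υ ~ x for an edge xy of M with y free, replace xy by xυ and leave y unmatched: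
-- x dominates y, and by (3) every vertex that only y dominated is υ itself.
module Submission where

open import Defs
open import Data.Nat using (ℕ)
open import Data.Nat.Properties using (<⇒≱)
open import Data.Bool using (true; false; T)
open import Data.Bool.Properties using (T?; T-≡)
open import Data.Empty using (⊥-elim)
open import Data.Fin using (Fin; _≟_)
open import Data.Fin.Subset using (Subset; _∈_; _∉_; _∩_; _⊆_; _⊂_)
open import Data.Fin.Subset.Properties using (_∈?_; x∈p∩q⁺; x∈p∩q⁻; p⊂q⇒∣p∣<∣q∣)
open import Data.Fin.Properties using (any?)
open import Data.Vec using (lookup)
open import Data.Vec.Properties using (lookup∘tabulate; lookup⇒[]=; []=⇒lookup)
open import Data.Product using (∃-syntax; _×_; _,_; proj₁; proj₂)
open import Data.Sum using (_⊎_; inj₁; inj₂; [_,_]′)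
open import Function using (_∘_; Equivalence)
open import Relation.Binary.PropositionalEquality using (_≡_; _≢_; refl; sym; trans; subst)
open import Relation.Nullary using (¬_; Dec; yes; no; contradiction)
open import Relation.Nullary.Decidable using (⌊_⌋; toWitness; fromWitness; _×-dec_; _⊎-dec_; ¬?)

T-injective : ∀ {x y} → (T x → T y) → (T y → T x) → x ≡ y
T-injective {false} {false} _ _ = refl
T-injective {false} {true}  _ g = ⊥-elim (g _)
T-injective {true}  {false} f _ = ⊥-elim (f _)
T-injective {true}  {true}  _ _ = refl

module _ {n : ℕ} (G : Graph n) where
  open Graph G

  Adj-sym : ∀ {u v} → Adj G u v → Adj G v u
  Adj-sym {u} {v} = subst T (adj-sym u v)

  Adj-irrefl : ∀ {u v} → Adj G u v → u ≢ v
  Adj-irrefl {u} uv refl = subst T (irrefl u) uv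

  lookup-VM : ∀ M v → lookup (VM G M) v ≡ ⌊ any? (λ u → T? (M v u)) ⌋
  lookup-VM M v = lookup∘tabulate _ v

  ∈VM⁺ : ∀ M {v u} → InE G M v u → v ∈ VM G M
  ∈VM⁺ M {v} {u} vu =
    lookup⇒[]= v (VM G M) (trans (lookup-VM M v) (Equivalence.to T-≡ (fromWitness (u , vu))))

  ∈VM⁻ : ∀ M {v} → v ∈ VM G M → ∃[ u ] InE G M v u
  ∈VM⁻ M {v} v∈ =
    toWitness (Equivalence.from T-≡ (trans (sym (lookup-VM M v)) ([]=⇒lookup v∈)))

  module Matching {M : EdgeSet G} (mm : IsMatching G M) where
    InE-sym : ∀ {u v} → InE G M u v → InE G M v u
    InE-sym {u} {v} = subst T (proj₁ mm u v)

    InE⇒Adj : ∀ {u v} → InE G M u v → Adj G u v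
    InE⇒Adj {u} {v} = proj₁ (proj₂ mm) u v

    partner-unique : ∀ {u v w} → InE G M u v → InE G M u w → v ≡ w
    partner-unique {u} {v} {w} = proj₂ (proj₂ mm) u v w

  isMatching : ∀ {M} → (∀ {u v} → InE G M u v → InE G M v u)
             → (∀ {u v} → InE G M u v → Adj G u v)
             → (∀ {u v w} → InE G M u v → InE G M u w → v ≡ w) → IsMatching G M
  isMatching M-sym M-adj M-unique =
    (λ u v → T-injective M-sym M-sym) , (λ u v → M-adj) , (λ u v w → M-unique)

  Dominating-⊆ : ∀ {S S′} → S ⊆ S′ → Dominating G S → Dominating G S′
  Dominating-⊆ S⊆S′ dom v v∉S′ with dom v (λ v∈S → v∉S′ (S⊆S′ v∈S))
  ... | u , u∈S , vu = u , S⊆S′ u∈S , vu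

  edgeSet : {P : Fin n → Fin n → Set} → (∀ u v → Dec (P u v)) → EdgeSet G
  edgeSet P? u v = ⌊ P? u v ⌋

  Link : Fin n → Fin n → Fin n → Fin n → Set
  Link a b u v = (u ≡ a × v ≡ b) ⊎ (u ≡ b × v ≡ a)

  Link-sym : ∀ {a b u v} → Link a b u v → Link a b v u
  Link-sym (inj₁ (ua , vb)) = inj₂ (vb , ua)
  Link-sym (inj₂ (ub , va)) = inj₁ (va , ub)

  Link-unique : ∀ {a b u v w} → a ≢ b → Link a b u v → Link a b u w → v ≡ w
  Link-unique a≢b (inj₁ (refl , refl)) (inj₁ (_ , refl)) = refl
  Link-unique a≢b (inj₁ (refl , _))    (inj₂ (refl , _)) = contradiction refl a≢b
  Link-unique a≢b (inj₂ (refl , _))    (inj₁ (refl , _)) = contradiction refl a≢b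
  Link-unique a≢b (inj₂ (refl , refl)) (inj₂ (_ , refl)) = refl

  insertEdge : Fin n → Fin n → EdgeSet G → EdgeSet G
  insertEdge a b M = edgeSet λ u v →
    (((u ≟ a) ×-dec (v ≟ b)) ⊎-dec ((u ≟ b) ×-dec (v ≟ a))) ⊎-dec T? (M u v)

  module _ {a b : Fin n} {M : EdgeSet G} where
    InE-insertEdge⁻ : ∀ {u v} → InE G (insertEdge a b M) u v → Link a b u v ⊎ InE G M u v
    InE-insertEdge⁻ = toWitness

    InE-insertEdge⁺ : ∀ {u v} → Link a b u v ⊎ InE G M u v → InE G (insertEdge a b M) u v
    InE-insertEdge⁺ = fromWitness

    insertEdge-matching : IsMatching G M → Adj G a b → a ∉ VM G M → b ∉ VM G M
                        → IsMatching G (insertEdge a b M)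
    insertEdge-matching mm ab a∉ b∉ = isMatching M′-sym M′-adj M′-unique
      where
        open Matching mm

        Link-unmatched : ∀ {u v w} → Link a b u v → ¬ InE G M u w
        Link-unmatched (inj₁ (refl , _)) uw = a∉ (∈VM⁺ M uw)
        Link-unmatched (inj₂ (refl , _)) uw = b∉ (∈VM⁺ M uw)

        M′-sym : ∀ {u v} → InE G (insertEdge a b M) u v → InE G (insertEdge a b M) v u
        M′-sym uv with InE-insertEdge⁻ uv
        ... | inj₁ l = InE-insertEdge⁺ (inj₁ (Link-sym l))
        ... | inj₂ m = InE-insertEdge⁺ (inj₂ (InE-sym m))

        M′-adj : ∀ {u v} → InE G (insertEdge a b M) u v → Adj G u v
        M′-adj uv with InE-insertEdge⁻ uv
        ... | inj₁ (inj₁ (refl , refl)) = ab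
        ... | inj₁ (inj₂ (refl , refl)) = Adj-sym ab
        ... | inj₂ m                    = InE⇒Adj m

        M′-unique : ∀ {u v w} → InE G (insertEdge a b M) u v → InE G (insertEdge a b M) u w
                  → v ≡ w
        M′-unique uv uw with InE-insertEdge⁻ uv | InE-insertEdge⁻ uw
        ... | inj₁ l | inj₁ l′ = Link-unique (Adj-irrefl ab) l l′
        ... | inj₁ l | inj₂ m′ = ⊥-elim (Link-unmatched l m′)
        ... | inj₂ m | inj₁ l′ = ⊥-elim (Link-unmatched l′ m)
        ... | inj₂ m | inj₂ m′ = partner-unique m m′

    VM-insertEdge⁺ : VM G M ⊆ VM G (insertEdge a b M)
    VM-insertEdge⁺ v∈ = ∈VM⁺ _ (InE-insertEdge⁺ (inj₂ (proj₂ (∈VM⁻ M v∈))))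

    source∈VM-insertEdge : a ∈ VM G (insertEdge a b M)
    source∈VM-insertEdge = ∈VM⁺ _ (InE-insertEdge⁺ {v = b} (inj₁ (inj₁ (refl , refl))))

    target∈VM-insertEdge : b ∈ VM G (insertEdge a b M)
    target∈VM-insertEdge = ∈VM⁺ _ (InE-insertEdge⁺ {v = a} (inj₁ (inj₂ (refl , refl))))

    VM-insertEdge⁻ : ∀ {v} → v ∈ VM G (insertEdge a b M) → v ∈ VM G M ⊎ v ≡ a ⊎ v ≡ b
    VM-insertEdge⁻ v∈ with ∈VM⁻ _ v∈
    ... | u , vu with InE-insertEdge⁻ vu
    ... | inj₁ (inj₁ (v≡a , _)) = inj₂ (inj₁ v≡a)
    ... | inj₁ (inj₂ (v≡b , _)) = inj₂ (inj₂ v≡b)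
    ... | inj₂ m                = inj₁ (∈VM⁺ M m)

  deleteVertex : Fin n → EdgeSet G → EdgeSet G
  deleteVertex x M = edgeSet λ u v → T? (M u v) ×-dec ¬? (u ≟ x) ×-dec ¬? (v ≟ x)

  module _ {x : Fin n} {M : EdgeSet G} where
    InE-deleteVertex⁻ : ∀ {u v} → InE G (deleteVertex x M) u v → InE G M u v × u ≢ x × v ≢ x
    InE-deleteVertex⁻ = toWitness

    InE-deleteVertex⁺ : ∀ {u v} → InE G M u v × u ≢ x × v ≢ x → InE G (deleteVertex x M) u v
    InE-deleteVertex⁺ = fromWitness

    deleteVertex-matching : IsMatching G M → IsMatching G (deleteVertex x M)
    deleteVertex-matching mm = isMatching
      (λ uv → let (m , u≢x , v≢x) = InE-deleteVertex⁻ uv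
              in InE-deleteVertex⁺ (InE-sym m , v≢x , u≢x))
      (λ uv → InE⇒Adj (proj₁ (InE-deleteVertex⁻ uv)))
      (λ uv uw → partner-unique (proj₁ (InE-deleteVertex⁻ uv)) (proj₁ (InE-deleteVertex⁻ uw)))
      where open Matching mm

    VM-deleteVertex⁻ : ∀ {v} → v ∈ VM G (deleteVertex x M) → v ∈ VM G M
    VM-deleteVertex⁻ v∈ = ∈VM⁺ M (proj₁ (InE-deleteVertex⁻ (proj₂ (∈VM⁻ _ v∈))))

    VM-deleteVertex⁺ : ∀ {v} → IsMatching G M → v ∈ VM G M → v ≢ x → ¬ InE G M x v
                     → v ∈ VM G (deleteVertex x M)
    VM-deleteVertex⁺ mm v∈ v≢x ¬xv with ∈VM⁻ M v∈
    ... | u , vu = ∈VM⁺ _ (InE-deleteVertex⁺ (vu , v≢x , λ { refl → ¬xv (InE-sym vu) }))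
      where open Matching mm

  rematch : Fin n → Fin n → Fin n → EdgeSet G → EdgeSet G
  rematch x y υ M = insertEdge x υ (deleteVertex y M)

  module Rematch {M : EdgeSet G} {x y υ : Fin n} (mm : IsMatching G M) (xy : InE G M x y)
                 (υx : Adj G υ x) (υ∉ : υ ∉ VM G M) where
    open Matching mm

    x∉deleteVertex : x ∉ VM G (deleteVertex y M)
    x∉deleteVertex x∈ with ∈VM⁻ (deleteVertex y M) x∈
    ... | u , xu = let (m , _ , u≢y) = InE-deleteVertex⁻ {y} {M} xu in u≢y (partner-unique m xy)

    rematch-matching : IsMatching G (rematch x y υ M)
    rematch-matching = insertEdge-matching (deleteVertex-matching mm) (Adj-sym υx)
      x∉deleteVertex (λ υ∈ → υ∉ (VM-deleteVertex⁻ υ∈))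

    VM-rematch⁺ : ∀ {v} → v ∈ VM G M → v ≢ y → v ∈ VM G (rematch x y υ M)
    VM-rematch⁺ {v} v∈ v≢y with v ≟ x
    ... | yes refl = source∈VM-insertEdge {M = deleteVertex y M}
    ... | no v≢x   = VM-insertEdge⁺
      (VM-deleteVertex⁺ mm v∈ v≢y (λ yv → v≢x (partner-unique yv (InE-sym xy))))

    VM-rematch⁻ : ∀ {v} → v ∈ VM G (rematch x y υ M) → v ∈ VM G M ⊎ v ≡ υ
    VM-rematch⁻ v∈ with VM-insertEdge⁻ {M = deleteVertex y M} v∈
    ... | inj₁ v∈′        = inj₁ (VM-deleteVertex⁻ v∈′)
    ... | inj₂ (inj₁ refl) = inj₁ (∈VM⁺ M xy)
    ... | inj₂ (inj₂ v≡υ)  = inj₂ v≡υ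

    y∉rematch : y ∉ VM G (rematch x y υ M)
    y∉rematch y∈ with VM-insertEdge⁻ {M = deleteVertex y M} y∈
    ... | inj₁ y∈′         =
      proj₁ (proj₂ (InE-deleteVertex⁻ {y} {M} (proj₂ (∈VM⁻ _ y∈′)))) refl
    ... | inj₂ (inj₁ y≡x)  = Adj-irrefl (InE⇒Adj xy) (sym y≡x)
    ... | inj₂ (inj₂ refl) = υ∉ (∈VM⁺ M (InE-sym xy))

    υ∈rematch : υ ∈ VM G (rematch x y υ M)
    υ∈rematch = target∈VM-insertEdge {M = deleteVertex y M}

    rematch-dominating : Dominating G (VM G M) → (∀ {w} → Adj G y w → w ≢ υ → w ∈ VM G M)
                       → Dominating G (VM G (rematch x y υ M))
    rematch-dominating dom y-neighbours v v∉ with v ≟ y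
    ... | yes refl = x , source∈VM-insertEdge {M = deleteVertex y M} , Adj-sym (InE⇒Adj xy)
    ... | no v≢y with dom v (λ v∈ → v∉ (VM-rematch⁺ v∈ v≢y))
    ... | u , u∈ , vu with u ≟ y
    ... | yes refl =
      ⊥-elim (v∉ (VM-rematch⁺ (y-neighbours (Adj-sym vu) λ { refl → v∉ υ∈rematch }) v≢y))
    ... | no u≢y   = u , VM-rematch⁺ u∈ u≢y , vu

  max-no-gain : ∀ {R M M′ r} → IsMaxMPD G R M → IsMPD G M′
              → (∀ {v} → v ∈ R → v ∈ VM G M → v ∈ VM G M′)
              → r ∈ R → r ∉ VM G M → r ∉ VM G M′
  max-no-gain {R} {M} {M′} {r} (_ , maximal) isMPD′ keeps r∈R r∉ r∈′ =
    <⇒≱ (p⊂q⇒∣p∣<∣q∣ gain) (maximal M′ isMPD′)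
    where
      gain : VM G M ∩ R ⊂ VM G M′ ∩ R
      gain = (λ v∈ → let (v∈M , v∈R) = x∈p∩q⁻ (VM G M) R v∈
                     in x∈p∩q⁺ (keeps v∈R v∈M , v∈R))
           , r , x∈p∩q⁺ (r∈′ , r∈R) , λ r∈ → r∉ (proj₁ (x∈p∩q⁻ (VM G M) R r∈))

  module MaximumMPD {R : Subset n} {M : EdgeSet G} (max : IsMaxMPD G R M)
                    {υ : Fin n} (υ∈R : υ ∈ R) (υ∉ : υ ∉ VM G M) where
    private
      mm  = proj₁ (proj₁ max)
      dom = proj₂ (proj₁ max)

    neighbours-matched : ∀ {w} → Adj G υ w → w ∈ VM G M
    neighbours-matched {w} υw with w ∈? VM G M
    ... | yes w∈ = w∈
    ... | no w∉  = ⊥-elim (max-no-gain max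
      (insertEdge-matching mm υw υ∉ w∉ , Dominating-⊆ VM-insertEdge⁺ dom)
      (λ _ → VM-insertEdge⁺) υ∈R υ∉ source∈VM-insertEdge)

    partner-neighbours-matched : ∀ {x y w} → InE G M x y → Adj G υ x → Adj G y w → w ≢ υ
                               → w ∈ VM G M
    partner-neighbours-matched {x} {y} {w} xy υx yw w≢υ with w ∈? VM G M
    ... | yes w∈ = w∈
    ... | no w∉  = ⊥-elim (max-no-gain max
      (M′-matching , Dominating-⊆ VM⊆M′ dom) (λ _ → VM⊆M′) υ∈R υ∉ (VM-insertEdge⁺ υ∈rematch))
      where
        open Rematch mm xy υx υ∉

        M′ : EdgeSet G
        M′ = insertEdge y w (rematch x y υ M)

        M′-matching : IsMatching G M′
        M′-matching =
          insertEdge-matching rematch-matching yw y∉rematch ([ w∉ , w≢υ ]′ ∘ VM-rematch⁻)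

        VM⊆M′ : VM G M ⊆ VM G M′
        VM⊆M′ {v} v∈ with v ≟ y
        ... | yes refl = source∈VM-insertEdge
        ... | no v≢y   = VM-insertEdge⁺ (VM-rematch⁺ v∈ v≢y)

    free-partner-not-adjacent : ∀ {x y} → InE G M x y → y ∉ R → ¬ Adj G υ x
    free-partner-not-adjacent {x} {y} xy y∉R υx = max-no-gain max
      (rematch-matching , rematch-dominating dom (partner-neighbours-matched xy υx))
      (λ v∈R v∈ → VM-rematch⁺ v∈ λ { refl → y∉R v∈R }) υ∈R υ∉ υ∈rematch
      where open Rematch mm xy υx υ∉

lemma3 : ∀ {n} (G : Graph n) (R : Subset n) (M : EdgeSet G) (υ : Fin n)
         → Connected G → NoIsolated G → IsMaxMPD G R M
         → υ ∈ R → υ ∉ VM G M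
         → (∀ a b → InE G M a b → a ∉ R → b ∉ R → ¬ Adj G υ a × ¬ Adj G υ b)
           × (∀ w → Adj G υ w → w ∈ VM G M)
           × (∀ a b → InE G M a b → (a ∈ R ⊎ b ∈ R) → Adj G υ a
                → ∀ w → Adj G b w → w ≢ υ → w ∈ VM G M)
           × (∀ a b → InE G M a b → a ∉ R → b ∈ R → ¬ Adj G υ b)
lemma3 G R M υ _ _ max υ∈R υ∉ =
    (λ a b ab a∉R b∉R → free-partner-not-adjacent ab b∉R , free-partner-not-adjacent (InE-sym ab) a∉R)
  , (λ w → neighbours-matched)
  , (λ a b ab _ υa w → partner-neighbours-matched ab υa)
  , (λ a b ab a∉R _ → free-partner-not-adjacent (InE-sym ab) a∉R)
  where
    open MaximumMPD G max υ∈R υ∉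
    open Matching G (proj₁ (proj₁ max))
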